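{- Let $(\mathcal P,\Phi)$ and $(\mathcal Q,\Psi)$ be rooted $k$-orbit $n$-polytopes whose symmetry type graphs are both (isomorphic, as edge-colored graphs, to) the same graph $G$. If, under these identifications, the orbit of $\Phi$ and the orbit of $\Psi$ correspond to the same vertex of $G$, then $(\mathcal P,\Phi)\diamond(\mathcal Q,\Psi)$ has at most $k$ flag orbits.
   Context: An $n$-polytope is an abstract polytope of rank $n$; for a flag $\Phi$ and $i\in\{0,\dots,n-1\}$, $\Phi^i$ is the unique flag differing from $\Phi$ only in its $i$-face. A rooted polytope is a pair $(\mathcal P,\Phi)$ with $\Phi$ a flag. A $k$-orbit polytope is one whose automorphism group has exactly $k$ orbits on flags. The symmetry type graph $T(\mathcal P)$ is the quotient of the flag graph (vertices: flags; $i$-edges: $\Phi\,\Phi^i$) by the automorphism group: one vertex per flag orbit, an $i$-edge between the orbits of $\Phi$ and $\Phi^i$, a semi-edge labeled $i$ when these coincide. The mix $(\mathcal P,\Phi)\diamond(\mathcal Q,\Psi)$ is the connected component containing $(\Phi,\Psi)$ of the graph on pairs of flags with an $i$-edge between $(\Phi_1,\Psi_1)$ and $(\Phi_2,\Psi_2)$ iff $\Phi_1\Phi_2$ and $\Psi_1\Psi_2$ are $i$-edges of the respective flag graphs; it is a maniplex whose flag orbits are the orbits of its color-preserving graph automorphism group on its vertices. -}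

module Defs where

open import Level using (0ℓ)
open import Data.Nat using (ℕ; suc; _+_)
open import Data.Fin as F using (Fin; zero; suc; inject₁; fromℕ)
open import Data.Product using (Σ; ∃; ∃-syntax; _×_; _,_; proj₁; proj₂)
open import Data.Sum using (_⊎_)
open import Relation.Nullary using (¬_)
open import Relation.Binary using (IsPartialOrder)
open import Relation.Binary.PropositionalEquality using (_≡_; _≢_)

-- Faces have ranks -1,0,...,n; rank r is stored as the element r+1 of
-- Fin (2 + n).  (P2) "every flag has n+2 faces" is encoded in the usual
-- equivalent way: a strictly monotone rank function with the least face
-- of rank -1, the greatest of rank n, and no gaps in ranks between
-- comparable faces.

record RankedPoset (n : ℕ) : Set₁ where
  field
    Face           : Set
    _≤_            : Face → Face → Set
    isPartialOrder : IsPartialOrder _≡_ _≤_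
    least          : Face
    greatest       : Face
    least-≤        : ∀ x → least ≤ x
    ≤-greatest     : ∀ x → x ≤ greatest
    rank           : Face → Fin (2 + n)
    rank-least     : rank least ≡ zero
    rank-greatest  : rank greatest ≡ fromℕ (suc n)
    rank-strict    : ∀ x y → x ≤ y → x ≢ y → rank x F.< rank y
    rank-interp    : ∀ x y → x ≤ y → ∀ r → rank x F.≤ r → r F.≤ rank y →
                     ∃[ z ] (x ≤ z × z ≤ y × rank z ≡ r)

  _<_ : Face → Face → Set
  x < y = x ≤ y × x ≢ y

module _ {n : ℕ} (P : RankedPoset n) where
  open RankedPoset P

  record Flag : Set where
    field
      face      : Fin (2 + n) → Face
      face-rank : ∀ r → rank (face r) ≡ r
      face-mono : ∀ r s → r F.≤ s → face r ≤ face s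
  open Flag public

  -- position in Fin (2+n) of the faces of rank i, for i ∈ {0,...,n-1}
  pos : Fin n → Fin (2 + n)
  pos i = suc (inject₁ i)

  _≈F_ : Flag → Flag → Set
  Φ ≈F Ψ = ∀ r → face Φ r ≡ face Ψ r

  Adj : Fin n → Flag → Flag → Set
  Adj i Φ Φ' = (∀ r → r ≢ pos i → face Φ r ≡ face Φ' r)
             × face Φ (pos i) ≢ face Φ' (pos i)

  data Walk (keep : Flag → Set) : Flag → Flag → Set where
    nil  : ∀ {Φ Ψ} → Φ ≈F Ψ → Walk keep Φ Ψ
    cons : ∀ {Φ Φ' Ψ} (i : Fin n) → Adj i Φ Φ' → keep Φ' →
           Walk keep Φ' Ψ → Walk keep Φ Ψ

  -- (P3) strong flag-connectivity: any two flags Φ, Ψ are joined by a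
  -- sequence of adjacent flags each containing Φ ∩ Ψ
  StronglyFlagConnected : Set
  StronglyFlagConnected =
    ∀ (Φ Ψ : Flag) →
      Walk (λ X → ∀ r → face Φ r ≡ face Ψ r → face X r ≡ face Φ r) Φ Ψ

  Diamond : Set
  Diamond =
    ∀ F G → F ≤ G → F.toℕ (rank G) ≡ 2 + F.toℕ (rank F) →
      ∃[ H₁ ] ∃[ H₂ ] (H₁ ≢ H₂ × F < H₁ × H₁ < G × F < H₂ × H₂ < G ×
        (∀ H → F < H → H < G → H ≡ H₁ ⊎ H ≡ H₂))

  record Automorphism : Set where
    field
      fun      : Face → Face
      inv      : Face → Face
      inv-fun  : ∀ x → inv (fun x) ≡ x
      fun-inv  : ∀ x → fun (inv x) ≡ x
      fun-mono : ∀ x y → x ≤ y → fun x ≤ fun y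
      inv-mono : ∀ x y → x ≤ y → inv x ≤ inv y

  SameOrbit : Flag → Flag → Set
  SameOrbit Φ Ψ = ∃[ α ] (∀ r → Automorphism.fun α (face Φ r) ≡ face Ψ r)

record Polytope (n : ℕ) : Set₁ where
  field
    poset   : RankedPoset n
    diamond : Diamond poset
    sfc     : StronglyFlagConnected poset
  open RankedPoset poset public

FlagOf : ∀ {n} → Polytope n → Set
FlagOf P = Flag (Polytope.poset P)

-- Edge-colored graphs with colors 0..n-1 on vertex set Fin k in which
-- every vertex has exactly one i-edge or i-semi-edge for each color i
-- (the shape of every symmetry type graph of an n-polytope):
-- σ i v is the other end of the i-edge at v (σ i v ≡ v: semi-edge).

record ColoredGraph (n k : ℕ) : Set where
  field
    σ     : Fin n → Fin k → Fin k
    σ-inv : ∀ i v → σ i (σ i v) ≡ v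

-- An identification of the symmetry type graph T(P) with G: the map ℓ
-- sends a flag to (the image in G of) its flag orbit.  ℓ is onto and its
-- fibres are exactly the flag orbits (so orbits ≅ Fin k, P is k-orbit),
-- and the orbits of Φ and Φ^i are sent to the two ends of an i-edge.
record STGIdentification {n k : ℕ} (P : Polytope n) (G : ColoredGraph n k) : Set where
  field
    ℓ        : FlagOf P → Fin k
    ℓ-onto   : ∀ v → ∃[ Φ ] (ℓ Φ ≡ v)
    ℓ-orbit  : ∀ Φ Ψ → ℓ Φ ≡ ℓ Ψ → SameOrbit (Polytope.poset P) Φ Ψ
    orbit-ℓ  : ∀ Φ Ψ → SameOrbit (Polytope.poset P) Φ Ψ → ℓ Φ ≡ ℓ Ψ
    ℓ-edge   : ∀ i Φ Φ' → Adj (Polytope.poset P) i Φ Φ' →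
               ℓ Φ' ≡ ColoredGraph.σ G i (ℓ Φ)

module _ {n : ℕ} (P Q : Polytope n) (Φ₀ : FlagOf P) (Ψ₀ : FlagOf Q) where
  private
    PP = Polytope.poset P
    QQ = Polytope.poset Q

  PairAdj : Fin n → FlagOf P × FlagOf Q → FlagOf P × FlagOf Q → Set
  PairAdj i (Φ₁ , Ψ₁) (Φ₂ , Ψ₂) = Adj PP i Φ₁ Φ₂ × Adj QQ i Ψ₁ Ψ₂

  data Reach : FlagOf P × FlagOf Q → Set where
    root : Reach (Φ₀ , Ψ₀)
    step : ∀ {x y} (i : Fin n) → Reach x → PairAdj i x y → Reach y

  MixFlag : Set
  MixFlag = Σ (FlagOf P × FlagOf Q) Reach

  _≈M_ : MixFlag → MixFlag → Set
  ((Φ₁ , Ψ₁) , _) ≈M ((Φ₂ , Ψ₂) , _) = _≈F_ PP Φ₁ Φ₂ × _≈F_ QQ Ψ₁ Ψ₂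

  MixAdj : Fin n → MixFlag → MixFlag → Set
  MixAdj i (x , _) (y , _) = PairAdj i x y

  record MixAutomorphism : Set where
    field
      fun      : MixFlag → MixFlag
      inv      : MixFlag → MixFlag
      fun-cong : ∀ x y → x ≈M y → fun x ≈M fun y
      inv-cong : ∀ x y → x ≈M y → inv x ≈M inv y
      inv-fun  : ∀ x → inv (fun x) ≈M x
      fun-inv  : ∀ x → fun (inv x) ≈M x
      fun-adj  : ∀ i x y → MixAdj i x y → MixAdj i (fun x) (fun y)
      inv-adj  : ∀ i x y → MixAdj i x y → MixAdj i (inv x) (inv y)

  -- the mix has at most k flag orbits: a map to Fin k whose fibres are
  -- contained in orbits of the color-preserving automorphism group
  MixHasAtMostOrbits : ℕ → Set
  MixHasAtMostOrbits k =
    Σ (MixFlag → Fin k) λ m → ∀ (x y : MixFlag) → m x ≡ m y →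
      ∃[ α ] (MixAutomorphism.fun α x ≈M y)

-- An automorphism of a polytope preserves ranks, so it acts on flags and
-- commutes with i-adjacency.  Along any walk in the mix starting at (Φ,Ψ),
-- the two coordinates follow the same edges of G, so their vertices in G
-- stay equal.  Hence two flags of the mix with the same vertex of G in the
-- first coordinate have the same vertex in both, and there are automorphisms
-- α of P and β of Q carrying one to the other coordinatewise; (α,β) maps the
-- mix, a connected component, onto itself and so is an automorphism of it.
module Submission where

open import Defs
open import Data.Nat using (ℕ)
open import Relation.Binary.PropositionalEquality using (_≡_)

import Data.Nat as ℕ
open import Data.Nat using (zero; suc; _+_; z≤n; s≤s)
open import Data.Nat.Properties using (≤-trans; ≤-<-trans; ≤-antisym; n≤1+n; 1+n≢n)
open import Data.Fin as Fin using (Fin; toℕ; fromℕ<)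
open import Data.Fin.Properties using (toℕ<n; toℕ-fromℕ<; toℕ-injective)
open import Data.Product using (Σ; ∃-syntax; _×_; _,_; proj₁; proj₂)
open import Data.Product.Relation.Binary.Pointwise.NonDependent using (×-setoid)
open import Function using (_∘_; _∘₂_)
open import Level using (0ℓ)
open import Relation.Binary using (Setoid)
open import Relation.Binary.PropositionalEquality
  using (_≢_; refl; sym; trans; cong; subst; module ≡-Reasoning)
import Relation.Binary.Reasoning.Setoid as SetoidReasoning

module FlagEquality {n : ℕ} (P : RankedPoset n) where

  -- _≈F_ wrapped in a record, so that the two flags can be inferred from a proof.
  record _≃_ (Φ Ψ : Flag P) : Set where
    constructor same-faces
    field faces : _≈F_ P Φ Ψ

  flagSetoid : Setoid 0ℓ 0ℓ
  flagSetoid = record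
    { Carrier       = Flag P
    ; _≈_           = _≃_
    ; isEquivalence = record
      { refl  = same-faces λ _ → refl
      ; sym   = λ (same-faces e) → same-faces (sym ∘ e)
      ; trans = λ (same-faces e) (same-faces f) → same-faces λ r → trans (e r) (f r) } }

  Adj-sym : ∀ {i} Φ Ψ → Adj P i Φ Ψ → Adj P i Ψ Φ
  Adj-sym _ _ (same , differ) = (λ r r≢i → sym (same r r≢i)) , (differ ∘ sym)

  Adj-respects-≃ : ∀ {i Φ Ψ Φ' Ψ'} → Φ ≃ Φ' → Ψ ≃ Ψ' → Adj P i Φ Ψ → Adj P i Φ' Ψ'
  Adj-respects-≃ (same-faces e) (same-faces f) (same , differ) =
    (λ r r≢i → trans (sym (e r)) (trans (same r r≢i) (f r))) ,
    (λ eq → differ (trans (e _) (trans eq (sym (f _)))))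

module AutomorphismProperties {n : ℕ} (P : RankedPoset n) where
  open RankedPoset P
  open Automorphism

  inverse : Automorphism P → Automorphism P
  inverse α = record
    { fun = inv α ; inv = fun α ; inv-fun = fun-inv α ; fun-inv = inv-fun α
    ; fun-mono = inv-mono α ; inv-mono = fun-mono α }

  fun-injective : (α : Automorphism P) {x y : Face} → fun α x ≡ fun α y → x ≡ y
  fun-injective α {x} {y} eq = begin
    x                ≡⟨ sym (inv-fun α x) ⟩
    inv α (fun α x)  ≡⟨ cong (inv α) eq ⟩
    inv α (fun α y)  ≡⟨ inv-fun α y ⟩
    y                ∎
    where open ≡-Reasoning

  fun-preserves-< : (α : Automorphism P) {x y : Face} → x ≤ y → x ≢ y →
                    rank (fun α x) Fin.< rank (fun α y)
  fun-preserves-< α {x} {y} x≤y x≢y =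
    rank-strict _ _ (fun-mono α x y x≤y) (x≢y ∘ fun-injective α)

  height : Face → ℕ
  height x = toℕ (rank x)

  face-below-of-height : ∀ x {m} → m ℕ.≤ height x → ∃[ z ] (z ≤ x × height z ≡ m)
  face-below-of-height x {m} m≤x =
    let z , _ , z≤x , rz≡r = rank-interp least x (least-≤ x) r least≤r r≤x
    in  z , z≤x , trans (cong toℕ rz≡r) (toℕ-fromℕ< m<2+n)
    where
    m<2+n : m ℕ.< 2 + n
    m<2+n = ≤-<-trans m≤x (toℕ<n (rank x))
    r : Fin (2 + n)
    r = fromℕ< m<2+n
    least≤r : rank least Fin.≤ r
    least≤r = subst (Fin._≤ r) (sym rank-least) z≤n
    r≤x : r Fin.≤ rank x
    r≤x = subst (ℕ._≤ height x) (sym (toℕ-fromℕ< m<2+n)) m≤x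

  -- Below a face of height m+1 lies one of height m, and its image lies strictly
  -- below the image of the face: so automorphisms never lower heights.
  height-≤-height-fun : (α : Automorphism P) → ∀ m x → height x ≡ m → m ℕ.≤ height (fun α x)
  height-≤-height-fun α zero    x _  = z≤n
  height-≤-height-fun α (suc m) x hx =
    let z , z≤x , hz = face-below-of-height x (subst (m ℕ.≤_) (sym hx) (n≤1+n m))
    in  ≤-trans (s≤s (height-≤-height-fun α m z hz)) (fun-preserves-< α z≤x (z≢x z hz))
    where
    z≢x : ∀ z → height z ≡ m → z ≢ x
    z≢x z hz z≡x = 1+n≢n (trans (sym hx) (trans (cong height (sym z≡x)) hz))

  rank-fun : (α : Automorphism P) → ∀ x → rank (fun α x) ≡ rank x
  rank-fun α x = toℕ-injective (≤-antisym fx≤x (height-≤-height-fun α _ x refl))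
    where
    fx≤x : height (fun α x) ℕ.≤ height x
    fx≤x = subst (λ y → height (fun α x) ℕ.≤ height y) (inv-fun α x)
                 (height-≤-height-fun (inverse α) _ (fun α x) refl)

  act : Automorphism P → Flag P → Flag P
  act α Φ = record
    { face      = fun α ∘ face Φ
    ; face-rank = λ r → trans (rank-fun α (face Φ r)) (face-rank Φ r)
    ; face-mono = λ r s r≤s → fun-mono α _ _ (face-mono Φ r s r≤s) }

  open FlagEquality P

  act-cong : (α : Automorphism P) {Φ Ψ : Flag P} → Φ ≃ Ψ → act α Φ ≃ act α Ψ
  act-cong α (same-faces e) = same-faces (cong (fun α) ∘ e)

  act-inverse : (α : Automorphism P) (Φ : Flag P) → act (inverse α) (act α Φ) ≃ Φ
  act-inverse α Φ = same-faces (inv-fun α ∘ face Φ)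

  act-Adj : (α : Automorphism P) {i : Fin n} (Φ Ψ : Flag P) →
            Adj P i Φ Ψ → Adj P i (act α Φ) (act α Ψ)
  act-Adj α _ _ (same , differ) = cong (fun α) ∘₂ same , differ ∘ fun-injective α

module MixAutomorphisms {n : ℕ} (P Q : Polytope n) (Φ₀ : FlagOf P) (Ψ₀ : FlagOf Q) where
  private
    PP = Polytope.poset P
    QQ = Polytope.poset Q
    module AP = AutomorphismProperties PP
    module AQ = AutomorphismProperties QQ
    module EP = FlagEquality PP
    module EQ = FlagEquality QQ

  Pair : Set
  Pair = FlagOf P × FlagOf Q

  pairSetoid : Setoid 0ℓ 0ℓ
  pairSetoid = ×-setoid EP.flagSetoid EQ.flagSetoid

  open Setoid pairSetoid using (_≈_) renaming (refl to ≈-refl; sym to ≈-sym)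
  open SetoidReasoning pairSetoid

  actPair : Automorphism PP → Automorphism QQ → Pair → Pair
  actPair α β (Φ , Ψ) = AP.act α Φ , AQ.act β Ψ

  actPair-cong : ∀ α β {a b} → a ≈ b → actPair α β a ≈ actPair α β b
  actPair-cong α β (eΦ , eΨ) = AP.act-cong α eΦ , AQ.act-cong β eΨ

  actPair-inverse : ∀ α β a → actPair (AP.inverse α) (AQ.inverse β) (actPair α β a) ≈ a
  actPair-inverse α β (Φ , Ψ) = AP.act-inverse α Φ , AQ.act-inverse β Ψ

  private
    PairAdj₀ : Fin n → Pair → Pair → Set
    PairAdj₀ = PairAdj P Q Φ₀ Ψ₀

    MixFlag₀ : Set
    MixFlag₀ = MixFlag P Q Φ₀ Ψ₀

    _≈M₀_ : MixFlag₀ → MixFlag₀ → Set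
    _≈M₀_ = _≈M_ P Q Φ₀ Ψ₀

  PairAdj-sym : ∀ {i} a b → PairAdj₀ i a b → PairAdj₀ i b a
  PairAdj-sym (Φ , Ψ) (Φ' , Ψ') (adjΦ , adjΨ) = EP.Adj-sym Φ Φ' adjΦ , EQ.Adj-sym Ψ Ψ' adjΨ

  PairAdj-respects-≈ : ∀ {i} a b {a' b'} → a ≈ a' → b ≈ b' → PairAdj₀ i a b → PairAdj₀ i a' b'
  PairAdj-respects-≈ _ _ (eΦ , eΨ) (fΦ , fΨ) (adjΦ , adjΨ) =
    EP.Adj-respects-≃ eΦ fΦ adjΦ , EQ.Adj-respects-≃ eΨ fΨ adjΨ

  actPair-PairAdj : ∀ α β {i} a b → PairAdj₀ i a b → PairAdj₀ i (actPair α β a) (actPair α β b)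
  actPair-PairAdj α β (Φ , Ψ) (Φ' , Ψ') (adjΦ , adjΨ) =
    AP.act-Adj α Φ Φ' adjΦ , AQ.act-Adj β Ψ Ψ' adjΨ

  -- Reach is not closed under ≈ (its root is one fixed pair), so the image of
  -- a flag of the mix is located in the mix only up to ≈.
  InMix : Pair → Set
  InMix a = Σ MixFlag₀ λ w → proj₁ w ≈ a

  InMix-step : ∀ {i} a b → InMix a → PairAdj₀ i a b → InMix b
  InMix-step {i} a b ((w , reach) , w≈a) adj =
    (b , step i reach (PairAdj-respects-≈ a b (≈-sym w≈a) ≈-refl adj)) , ≈-refl

  InMix-actPair : ∀ α β → InMix (actPair α β (Φ₀ , Ψ₀)) →
                  ∀ {z} → Reach P Q Φ₀ Ψ₀ z → InMix (actPair α β z)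
  InMix-actPair α β root-in root = root-in
  InMix-actPair α β root-in (step {x} {y} i reach adj) =
    InMix-step _ _ (InMix-actPair α β root-in reach) (actPair-PairAdj α β x y adj)

  InMix-actPair-root : ∀ α β {z} → Reach P Q Φ₀ Ψ₀ z → InMix (actPair α β z) →
                       InMix (actPair α β (Φ₀ , Ψ₀))
  InMix-actPair-root α β root z-in = z-in
  InMix-actPair-root α β (step {x} {y} i reach adj) y-in =
    InMix-actPair-root α β reach
      (InMix-step _ _ y-in (actPair-PairAdj α β y x (PairAdj-sym x y adj)))

  ≈⇒≈M : ∀ (w w' : MixFlag₀) → proj₁ w ≈ proj₁ w' → w ≈M₀ w'
  ≈⇒≈M _ _ (EP.same-faces eΦ , EQ.same-faces eΨ) = eΦ , eΨ

  ≈M⇒≈ : ∀ (w w' : MixFlag₀) → w ≈M₀ w' → proj₁ w ≈ proj₁ w'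
  ≈M⇒≈ _ _ (eΦ , eΨ) = EP.same-faces eΦ , EQ.same-faces eΨ

  module Induced (α : Automorphism PP) (β : Automorphism QQ)
                 (root-in : InMix (actPair α β (Φ₀ , Ψ₀))) where

    induced : MixFlag₀ → MixFlag₀
    induced (_ , reach) = proj₁ (InMix-actPair α β root-in reach)

    induced-≈ : ∀ w → proj₁ (induced w) ≈ actPair α β (proj₁ w)
    induced-≈ (_ , reach) = proj₂ (InMix-actPair α β root-in reach)

    induced-cong : ∀ w w' → w ≈M₀ w' → induced w ≈M₀ induced w'
    induced-cong w w' w≈w' = ≈⇒≈M (induced w) (induced w') (begin
      proj₁ (induced w)       ≈⟨ induced-≈ w ⟩
      actPair α β (proj₁ w)   ≈⟨ actPair-cong α β (≈M⇒≈ w w' w≈w') ⟩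
      actPair α β (proj₁ w')  ≈⟨ induced-≈ w' ⟨
      proj₁ (induced w')      ∎)

    induced-MixAdj : ∀ i w w' → MixAdj P Q Φ₀ Ψ₀ i w w' →
                     MixAdj P Q Φ₀ Ψ₀ i (induced w) (induced w')
    induced-MixAdj i w w' adj =
      PairAdj-respects-≈ _ _ (≈-sym (induced-≈ w)) (≈-sym (induced-≈ w'))
        (actPair-PairAdj α β (proj₁ w) (proj₁ w') adj)

  induced-inverse : ∀ α β root-in root-in⁻¹ w →
    Induced.induced (AP.inverse α) (AQ.inverse β) root-in⁻¹ (Induced.induced α β root-in w) ≈M₀ w
  induced-inverse α β root-in root-in⁻¹ w = ≈⇒≈M (G.induced (F.induced w)) w (begin
    proj₁ (G.induced (F.induced w))          ≈⟨ G.induced-≈ (F.induced w) ⟩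
    actPair α⁻¹ β⁻¹ (proj₁ (F.induced w))    ≈⟨ actPair-cong α⁻¹ β⁻¹ (F.induced-≈ w) ⟩
    actPair α⁻¹ β⁻¹ (actPair α β (proj₁ w))  ≈⟨ actPair-inverse α β (proj₁ w) ⟩
    proj₁ w                                  ∎)
    where
    α⁻¹ = AP.inverse α
    β⁻¹ = AQ.inverse β
    module F = Induced α β root-in
    module G = Induced α⁻¹ β⁻¹ root-in⁻¹

  -- fun-inv is induced-inverse for (α⁻¹,β⁻¹), as inverse (inverse α) = α by eta.
  liftAutomorphisms : ∀ α β (x y : MixFlag₀) → actPair α β (proj₁ x) ≈ proj₁ y →
                      ∃[ γ ] (MixAutomorphism.fun γ x ≈M₀ y)
  liftAutomorphisms α β x y αβx≈y = γ , ≈⇒≈M (F.induced x) y (begin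
    proj₁ (F.induced x)     ≈⟨ F.induced-≈ x ⟩
    actPair α β (proj₁ x)   ≈⟨ αβx≈y ⟩
    proj₁ y                 ∎)
    where
    α⁻¹ = AP.inverse α
    β⁻¹ = AQ.inverse β
    root-in : InMix (actPair α β (Φ₀ , Ψ₀))
    root-in = InMix-actPair-root α β (proj₂ x) (y , ≈-sym αβx≈y)
    root-in⁻¹ : InMix (actPair α⁻¹ β⁻¹ (Φ₀ , Ψ₀))
    root-in⁻¹ = InMix-actPair-root α⁻¹ β⁻¹ (proj₂ y) (x , (begin
      proj₁ x                                  ≈⟨ actPair-inverse α β (proj₁ x) ⟨
      actPair α⁻¹ β⁻¹ (actPair α β (proj₁ x))  ≈⟨ actPair-cong α⁻¹ β⁻¹ αβx≈y ⟩
      actPair α⁻¹ β⁻¹ (proj₁ y)                ∎))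
    module F = Induced α β root-in
    module G = Induced α⁻¹ β⁻¹ root-in⁻¹
    γ : MixAutomorphism P Q Φ₀ Ψ₀
    γ = record
      { fun      = F.induced
      ; inv      = G.induced
      ; fun-cong = F.induced-cong
      ; inv-cong = G.induced-cong
      ; inv-fun  = induced-inverse α β root-in root-in⁻¹
      ; fun-inv  = induced-inverse α⁻¹ β⁻¹ root-in⁻¹ root-in
      ; fun-adj  = F.induced-MixAdj
      ; inv-adj  = G.induced-MixAdj }

module _ {n k : ℕ} {G : ColoredGraph n k} {P Q : Polytope n}
         (ιP : STGIdentification P G) (ιQ : STGIdentification Q G) where
  open STGIdentification
  open ColoredGraph G

  Reach⇒same-vertex : ∀ {Φ₀ Ψ₀} → ℓ ιP Φ₀ ≡ ℓ ιQ Ψ₀ →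
                      ∀ {z} → Reach P Q Φ₀ Ψ₀ z → ℓ ιP (proj₁ z) ≡ ℓ ιQ (proj₂ z)
  Reach⇒same-vertex root-same root = root-same
  Reach⇒same-vertex root-same (step {x} {y} i reach (adjΦ , adjΨ)) = begin
    ℓ ιP (proj₁ y)        ≡⟨ ℓ-edge ιP i _ _ adjΦ ⟩
    σ i (ℓ ιP (proj₁ x))  ≡⟨ cong (σ i) (Reach⇒same-vertex root-same reach) ⟩
    σ i (ℓ ιQ (proj₂ x))  ≡⟨ ℓ-edge ιQ i _ _ adjΨ ⟨
    ℓ ιQ (proj₂ y)        ∎
    where open ≡-Reasoning

mainTheorem4 : ∀ {n k : ℕ} (G : ColoredGraph n k) (P Q : Polytope n)
    (Φ : FlagOf P) (Ψ : FlagOf Q)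
    (ιP : STGIdentification P G) (ιQ : STGIdentification Q G) →
    STGIdentification.ℓ ιP Φ ≡ STGIdentification.ℓ ιQ Ψ →
    MixHasAtMostOrbits P Q Φ Ψ k
mainTheorem4 G P Q Φ Ψ ιP ιQ root-same = ℓ ιP ∘ proj₁ ∘ proj₁ , same-vertex⇒same-orbit
  where
  open STGIdentification
  open MixAutomorphisms P Q Φ Ψ
  open FlagEquality using (same-faces)

  same-vertex⇒same-orbit : ∀ x y → ℓ ιP (proj₁ (proj₁ x)) ≡ ℓ ιP (proj₁ (proj₁ y)) →
                           ∃[ γ ] _≈M_ P Q Φ Ψ (MixAutomorphism.fun γ x) y
  same-vertex⇒same-orbit x@((Φx , Ψx) , reach-x) y@((Φy , Ψy) , reach-y) sameΦ =
    let α , αΦx≡Φy = ℓ-orbit ιP Φx Φy sameΦ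
        β , βΨx≡Ψy = ℓ-orbit ιQ Ψx Ψy sameΨ
    in  liftAutomorphisms α β x y (same-faces αΦx≡Φy , same-faces βΨx≡Ψy)
    where
    sameΨ : ℓ ιQ Ψx ≡ ℓ ιQ Ψy
    sameΨ = trans (sym (Reach⇒same-vertex ιP ιQ root-same reach-x))
                  (trans sameΦ (Reach⇒same-vertex ιP ιQ root-same reach-y))
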